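{- Let $G$ be a $\kappa$-connected graph of order $n$ and size $m$, with $\tfrac{1}{2} [n(3\kappa-1) - 2\kappa^2 - \kappa+1 - b(\kappa-b)] \leq m \leq \binom{n-1}{2}$, where $b$ is the integer in $\{1,2,\ldots, \kappa\}$ with $b \equiv n-1 \pmod{\kappa}$. Let $m^*$ be the smallest integer with $m^*\geq m$ and $m^* \equiv \binom{n-1}{2} \pmod{\kappa}$. Then \[ \rho(G) \leq \frac{n}{2\kappa} +2 - \frac{1}{\kappa} - \frac{\kappa-1}{n-1} - \frac{m^*}{\kappa(n-1)}, \] and this bound is sharp.
   Context: All graphs are finite, simple and connected. For a connected graph $G$ of order $n\ge 2$ and a vertex $v$, $\overline{\sigma}_G(v)=\frac{1}{n-1}\sum_{w\in V(G)} d_G(v,w)$; the remoteness is $\rho(G)=\max_{v}\overline{\sigma}_G(v)$. Size means number of edges. A graph is $\kappa$-connected if removing fewer than $\kappa$ vertices leaves it connected. -}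

module Defs where

open import Data.Bool using (Bool; true; false; _∧_; _∨_; if_then_else_; not)
open import Data.Nat as ℕ using (ℕ; zero; suc; _∸_; _≤_; _≥_; NonZero; _%_)
open import Data.Nat.Combinatorics using (_C_)
open import Data.Fin using (Fin; toℕ; _<?_)
open import Data.List using (List; []; _∷_; map; foldr; length; filter; concatMap)
open import Data.Bool.ListAction using (any)
open import Data.Nat.ListAction using (sum)
open import Data.Vec.Functional using () 
open import Data.Fin.Base using ()
open import Data.List.Base using () renaming (allFin to allFinL)
open import Data.Integer as ℤ using (ℤ; +_)
open import Data.Rational as ℚ using (ℚ)
open import Data.Product using (Σ; _×_; _,_; ∃)
open import Relation.Binary.PropositionalEquality using (_≡_)
open import Relation.Nullary.Decidable using (⌊_⌋)

record Graph (n : ℕ) : Set where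
  field
    adj    : Fin n → Fin n → Bool
    sym    : ∀ i j → adj i j ≡ adj j i
    irrefl : ∀ i → adj i i ≡ false
open Graph public

verts : (n : ℕ) → List (Fin n)
verts n = allFinL n

reachIn : ∀ {n} → Graph n → (Fin n → Bool) → ℕ → Fin n → Fin n → Bool
reachIn {n} G keep zero    u v = keep u ∧ ⌊ u Data.Fin.≟ v ⌋
  where import Data.Fin
reachIn {n} G keep (suc k) u v =
  reachIn G keep k u v ∨ any (λ w → reachIn G keep k u w ∧ adj G w v ∧ keep v) (verts n)

allV : ∀ {n} → Fin n → Bool
allV _ = true

reach : ∀ {n} → Graph n → ℕ → Fin n → Fin n → Bool
reach G = reachIn G allV

-- distance: least k with a walk of length ≤ k, searched up to n
-- (for connected graphs every distance is < n, so the cutoff is never hit)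
distFrom : ∀ {n} → Graph n → Fin n → Fin n → ℕ → ℕ → ℕ
distFrom G u v k zero = k
distFrom G u v k (suc fuel) = if reach G k u v then k else distFrom G u v (suc k) fuel

dist : ∀ {n} → Graph n → Fin n → Fin n → ℕ
dist {n} G u v = distFrom G u v 0 n

Connected : ∀ {n} → Graph n → Set
Connected {n} G = ∀ u v → reach G n u v ≡ true

removed : ∀ {n} → (Fin n → Bool) → ℕ
removed {n} keep = length (filter (λ v → not (keep v) ≡? true) (verts n))
  where
    open import Data.Bool.Properties using () renaming (_≟_ to _≡?_)

InducedConnected : ∀ {n} → Graph n → (Fin n → Bool) → Set
InducedConnected {n} G keep =
  Σ (Fin n) (λ w → keep w ≡ true) ×
  (∀ u v → keep u ≡ true → keep v ≡ true → reachIn G keep n u v ≡ true)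

-- κ-connected: removing fewer than κ vertices leaves a (nonempty) connected graph
KConnected : ∀ {n} → ℕ → Graph n → Set
KConnected {n} κ G = ∀ (keep : Fin n → Bool) → suc (removed keep) ≤ κ → InducedConnected G keep

size : ∀ {n} → Graph n → ℕ
size {n} G = length (filter (λ p → ⌊ Data.Product.proj₁ p <? Data.Product.proj₂ p ⌋ ∧ adj G (Data.Product.proj₁ p) (Data.Product.proj₂ p) ≡? true)
                      (concatMap (λ i → map (λ j → (i , j)) (verts n)) (verts n)))
  where
    open import Data.Bool.Properties using () renaming (_≟_ to _≡?_)
    import Data.Product

transmission : ∀ {n} → Graph n → Fin n → ℕ
transmission {n} G v = sum (map (dist G v) (verts n))

-- a / d as a rational (d = 0 yields 0; only used with d ≥ 1)
frac : ℕ → ℕ → ℚ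
frac a zero = ℚ.0ℚ
frac a (suc d) = (+ a) ℚ./ suc d

meanDist : ∀ {n} → Graph n → Fin n → ℚ
meanDist {n} G v = frac (transmission G v) (n ∸ 1)

-- remoteness ρ(G) = max_v σ̄_G(v)  (all values are ≥ 0, so folding with 0 is the max for n ≥ 1)
remoteness : ∀ {n} → Graph n → ℚ
remoteness {n} G = foldr (λ v r → meanDist G v ℚ.⊔ r) ℚ.0ℚ (verts n)

IsB : (κ n b : ℕ) → .{{_ : NonZero κ}} → Set
IsB κ n b = (1 ≤ b) × (b ≤ κ) × (b % κ ≡ (n ∸ 1) % κ)

IsMStar : (κ n m mstar : ℕ) → .{{_ : NonZero κ}} → Set
IsMStar κ n m mstar =
  (m ≤ mstar) × (mstar % κ ≡ ((n ∸ 1) C 2) % κ) ×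
  (∀ m′ → m ≤ m′ → m′ % κ ≡ ((n ∸ 1) C 2) % κ → mstar ≤ m′)

-- the hypothesis  ½[n(3κ-1) - 2κ² - κ + 1 - b(κ-b)] ≤ m ≤ C(n-1,2), lower bound stated as
-- n(3κ-1) - 2κ² - κ + 1 - b(κ-b) ≤ 2m over ℤ
SizeRange : (κ n b m : ℕ) → Set
SizeRange κ n b m =
  (+ n ℤ.* (+ (3 ℕ.* κ) ℤ.- + 1) ℤ.- + (2 ℕ.* κ ℕ.* κ) ℤ.- + κ ℤ.+ + 1
     ℤ.- + b ℤ.* (+ κ ℤ.- + b)) ℤ.≤ + (2 ℕ.* m)
  × (m ≤ (n ∸ 1) C 2)

bound : (κ n mstar : ℕ) → ℚ
bound κ n mstar =
  frac n (2 ℕ.* κ) ℚ.+ frac 2 1 ℚ.- frac 1 κ ℚ.- frac (κ ∸ 1) (n ∸ 1)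
    ℚ.- frac mstar (κ ℕ.* (n ∸ 1))

{-# OPTIONS --safe #-}
-- Fix a vertex v, let d be the distance from v, κ = k + 1 and D = n - 1. If some vertex is at
-- distance at least 2, every layer d = i with 0 < i < max d separates v from the vertices beyond
-- it, so it has at least κ vertices. Hence a vertex w with d w = t + 2 lies at least two layers
-- above at least 1 + tκ vertices, and summing over w gives κ σ(v) + k |{d = 1}| ≤ T + (2k + 1) D,
-- where T counts the pairs (w, u) with d u + 2 ≤ d w. Such a pair is not an edge and an unordered
-- pair is counted at most once, so T + m ≤ C(n, 2). Together (or directly, when v is adjacent to
-- every other vertex) m + (σ(v) + k) κ ≤ C(D, 2) + 2Dκ. The right-hand side minus (σ(v) + k) κ is
-- congruent to C(D, 2) modulo κ, so the inequality survives replacing m by m*, and it then says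
-- exactly σ(v) / D ≤ bound. Equality holds for the graph made of levels of sizes 1, κ, κ and
-- κ(N + 1), each a clique, with consecutive levels completely joined.
module Submission where

open import Defs
open import Data.Nat using (ℕ; _≤_; _≥_; NonZero)
open import Data.Rational using (ℚ) renaming (_≤_ to _≤ℚ_)
open import Data.Product using (Σ; _×_)
open import Relation.Binary.PropositionalEquality using (_≡_)

open import Data.Nat as ℕ using (zero; suc; _+_; _*_; _∸_; _<_; z≤n; s≤s; _≤?_)
import Data.Nat.Properties as ℕP
open import Data.Nat.Tactic.RingSolver using (solve-∀)
open import Data.Nat.Combinatorics using (_C_; nC1≡n; nCk+nC[k+1]≡[n+1]C[k+1])
open import Data.Fin as Fin using (Fin)
import Data.Fin.Properties as FinP
open import Data.Bool using (Bool; true; false; not; _∧_; _∨_)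
import Data.Bool.Properties as BoolP
open import Data.List using (List; []; _∷_; _++_; map; foldr; filter; length; concatMap; tabulate; allFin)
import Data.List.Properties as ListP
open import Data.Nat.ListAction using () renaming (sum to listSum)
open import Data.Nat.ListAction.Properties using (sum-++)
open import Data.Bool.ListAction using (any)
open import Data.List.Relation.Unary.Any using (satisfied)
open import Data.List.Relation.Unary.Any.Properties using (any⁺; any⁻)
open import Data.List.Membership.Propositional using (lose)
open import Data.List.Membership.Propositional.Properties using (∈-allFin)
open import Data.Product using (∃-syntax; _,_; proj₁; proj₂)
open import Data.Sum using (_⊎_; inj₁; inj₂; [_,_]′)
open import Relation.Binary.Definitions using (tri<; tri≈; tri>)
open import Data.Empty using (⊥-elim)
open import Function using (_∘_; id; _⇔_; mk⇔; Equivalence)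
open import Relation.Nullary using (¬_; Dec; yes; no)
open import Relation.Nullary.Decidable using (⌊_⌋; isYes≗does; dec-true; dec-false; does-⇔; toWitness)
open import Relation.Binary.PropositionalEquality
  using (_≢_; refl; trans; cong; cong₂; subst; module ≡-Reasoning)
import Relation.Binary.PropositionalEquality as ≡
open import Data.Nat.DivMod using (_%_; [m+kn]%n≡m%n)
open import Data.Integer as ℤ using (ℤ)
import Data.Integer.Properties as ℤP
import Data.Integer.Tactic.RingSolver as ℤ-Solver
open import Data.Rational as ℚ using (toℚᵘ)
import Data.Rational.Properties as ℚP
open import Data.Rational.Unnormalised as ℚᵘ using (ℚᵘ; mkℚᵘ; _≃_; *≡*)
import Data.Rational.Unnormalised.Properties as ℚᵘP
open import Algebra.Properties.Semiring.Sum ℕP.+-*-semiring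
  using (sum; sum-syntax; sum-remove; ∑-distrib-+; ∑-comm; sum-cong-≗; *-distribʳ-sum)
open import Data.Vec.Functional using (removeAt)

open Equivalence using (to; from)

-- Finite sums

⌊⌋-true : ∀ {A : Set} (a? : Dec A) → A → ⌊ a? ⌋ ≡ true
⌊⌋-true a? a = trans (isYes≗does a?) (dec-true a? a)

⌊⌋-false : ∀ {A : Set} (a? : Dec A) → ¬ A → ⌊ a? ⌋ ≡ false
⌊⌋-false a? ¬a = trans (isYes≗does a?) (dec-false a? ¬a)

⌊⌋-⇔ : ∀ {A B : Set} → A ⇔ B → (a? : Dec A) (b? : Dec B) → ⌊ a? ⌋ ≡ ⌊ b? ⌋
⌊⌋-⇔ A⇔B a? b? = trans (isYes≗does a?) (trans (does-⇔ A⇔B a? b?) (≡.sym (isYes≗does b?)))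

⌊⌋-true⁻ : ∀ {A : Set} (a? : Dec A) → ⌊ a? ⌋ ≡ true → A
⌊⌋-true⁻ a? h = toWitness (from BoolP.T-≡ h)

𝟙 : Bool → ℕ
𝟙 true  = 1
𝟙 false = 0

𝟙≤1 : ∀ b → 𝟙 b ≤ 1
𝟙≤1 true  = ℕP.≤-refl
𝟙≤1 false = z≤n

𝟙-mono : ∀ {a b} → (a ≡ true → b ≡ true) → 𝟙 a ≤ 𝟙 b
𝟙-mono {false}         _   = z≤n
𝟙-mono {true}  {true}  _   = ℕP.≤-refl
𝟙-mono {true}  {false} a⇒b with () ← a⇒b refl

∑-const : ∀ n c → ∑[ i < n ] c ≡ n * c
∑-const zero    c = refl
∑-const (suc n) c = cong (c +_) (∑-const n c)

∑-mono-≤ : ∀ {n} {f g : Fin n → ℕ} → (∀ i → f i ≤ g i) → sum f ≤ sum g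
∑-mono-≤ {zero}  _   = z≤n
∑-mono-≤ {suc n} f≤g = ℕP.+-mono-≤ (f≤g Fin.zero) (∑-mono-≤ (f≤g ∘ Fin.suc))

term≤∑ : ∀ {n} (f : Fin n → ℕ) i → f i ≤ sum f
term≤∑ f Fin.zero    = ℕP.m≤m+n _ _
term≤∑ f (Fin.suc i) = ℕP.≤-trans (term≤∑ (f ∘ Fin.suc) i) (ℕP.m≤n+m _ _)

∑<n : ∀ {n} (f : Fin n → ℕ) i → (∀ j → f j ≤ 1) → f i ≡ 0 → sum f < n
∑<n {suc n} f i f≤1 fi≡0 = s≤s (begin
  sum f                      ≡⟨ sum-remove {i = i} f ⟩
  f i + sum (removeAt f i)   ≡⟨ cong (_+ sum (removeAt f i)) fi≡0 ⟩
  sum (removeAt f i)         ≤⟨ ∑-mono-≤ (f≤1 ∘ Fin.punchIn i) ⟩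
  sum {n} (λ _ → 1)          ≡⟨ trans (∑-const n 1) (ℕP.*-identityʳ n) ⟩
  n                          ∎)
  where open ℕP.≤-Reasoning

∑-ones-but-one : ∀ {n} (f : Fin n → ℕ) i → f i ≡ 0 → (∀ j → j ≢ i → f j ≡ 1) → suc (sum f) ≡ n
∑-ones-but-one {suc n} f i fi≡0 fj≡1 = cong suc (begin
  sum f                      ≡⟨ sum-remove {i = i} f ⟩
  f i + sum (removeAt f i)   ≡⟨ cong (_+ sum (removeAt f i)) fi≡0 ⟩
  sum (removeAt f i)         ≡⟨ sum-cong-≗ (λ j → fj≡1 _ (FinP.punchInᵢ≢i i j)) ⟩
  sum {n} (λ _ → 1)          ≡⟨ trans (∑-const n 1) (ℕP.*-identityʳ n) ⟩
  n                          ∎)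
  where open ≡-Reasoning

∑-split : ∀ a b (f : Fin (a + b) → ℕ) → sum f ≡ ∑[ i < a ] f (i Fin.↑ˡ b) + ∑[ i < b ] f (a Fin.↑ʳ i)
∑-split zero    b f = refl
∑-split (suc a) b f =
  trans (cong (f Fin.zero +_) (∑-split a b (f ∘ Fin.suc))) (≡.sym (ℕP.+-assoc (f Fin.zero) _ _))

listSum-tabulate : ∀ {n} (f : Fin n → ℕ) → listSum (tabulate f) ≡ sum f
listSum-tabulate {zero}  f = refl
listSum-tabulate {suc n} f = cong (f Fin.zero +_) (listSum-tabulate (f ∘ Fin.suc))

listSum-map-allFin : ∀ {n} (f : Fin n → ℕ) → listSum (map f (allFin n)) ≡ sum f
listSum-map-allFin f = trans (cong listSum (ListP.map-tabulate id f)) (listSum-tabulate f)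

listSum-concatMap : ∀ {A B : Set} (f : B → ℕ) (g : A → List B) xs →
  listSum (map f (concatMap g xs)) ≡ listSum (map (λ x → listSum (map f (g x))) xs)
listSum-concatMap f g []       = refl
listSum-concatMap f g (x ∷ xs) = begin
  listSum (map f (g x ++ concatMap g xs))
    ≡⟨ cong listSum (ListP.map-++ f (g x) (concatMap g xs)) ⟩
  listSum (map f (g x) ++ map f (concatMap g xs))
    ≡⟨ sum-++ (map f (g x)) _ ⟩
  listSum (map f (g x)) + listSum (map f (concatMap g xs))
    ≡⟨ cong (listSum (map f (g x)) +_) (listSum-concatMap f g xs) ⟩
  listSum (map (λ x → listSum (map f (g x))) (x ∷ xs)) ∎
  where open ≡-Reasoning

length-filter-true : ∀ {A : Set} (p : A → Bool) xs →
  length (filter (λ x → p x BoolP.≟ true) xs) ≡ listSum (map (𝟙 ∘ p) xs)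
length-filter-true p []       = refl
length-filter-true p (x ∷ xs) with p x
... | true  = cong suc (length-filter-true p xs)
... | false = length-filter-true p xs

any-allFin⁺ : ∀ {n} (p : Fin n → Bool) i → p i ≡ true → any p (allFin n) ≡ true
any-allFin⁺ p i pi = to BoolP.T-≡ (any⁺ p (lose (∈-allFin i) (from BoolP.T-≡ pi)))

any-allFin⁻ : ∀ {n} (p : Fin n → Bool) → any p (allFin n) ≡ true → ∃[ i ] p i ≡ true
any-allFin⁻ {n} p h with i , pi ← satisfied (any⁻ p (allFin n) (from BoolP.T-≡ h)) = i , to BoolP.T-≡ pi

-- Walks, distances and vertex removal

removed≡∑ : ∀ {n} (keep : Fin n → Bool) → removed keep ≡ ∑[ u < n ] 𝟙 (not (keep u))
removed≡∑ {n} keep = trans (length-filter-true (not ∘ keep) (allFin n)) (listSum-map-allFin (𝟙 ∘ not ∘ keep))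

module Walks {n : ℕ} (G : Graph n) (keep : Fin n → Bool) where

  reachIn-refl : ∀ {u} → keep u ≡ true → reachIn G keep 0 u u ≡ true
  reachIn-refl {u} ku rewrite ku = ⌊⌋-true (u Fin.≟ u) refl

  reachIn-suc : ∀ {k u y} → reachIn G keep k u y ≡ true → reachIn G keep (suc k) u y ≡ true
  reachIn-suc r rewrite r = refl

  reachIn-step : ∀ {k u x y} → reachIn G keep k u x ≡ true → adj G x y ≡ true → keep y ≡ true →
                 reachIn G keep (suc k) u y ≡ true
  reachIn-step {k} {u} {x} {y} r a ky =
    trans (cong (reachIn G keep k u y ∨_) (any-allFin⁺ _ x (cong₂ _∧_ r (cong₂ _∧_ a ky))))
          (BoolP.∨-zeroʳ _)

  reachIn-mono : ∀ {j k u y} → j ≤ k → reachIn G keep j u y ≡ true → reachIn G keep k u y ≡ true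
  reachIn-mono j≤k = go (ℕP.≤⇒≤′ j≤k)
    where
    go : ∀ {j k u y} → j ℕ.≤′ k → reachIn G keep j u y ≡ true → reachIn G keep k u y ≡ true
    go ℕ.≤′-refl        r = r
    go {k = suc k} {u} {y} (ℕ.≤′-step j≤′k) r = reachIn-suc {k} {u} {y} (go j≤′k r)

  reachIn-elim : ∀ (P : ℕ → Fin n → Set) {u} → P 0 u →
    (∀ {k x} → P k x → P (suc k) x) →
    (∀ {k x y} → P k x → adj G x y ≡ true → keep y ≡ true → P (suc k) y) →
    ∀ {k y} → reachIn G keep k u y ≡ true → P k y
  reachIn-elim P {u} base stay step {zero} {y} r with u Fin.≟ y
  ... | yes refl = base
  ... | no _ with () ← BoolP.∧-conicalʳ (keep u) false r
  reachIn-elim P {u} base stay step {suc k} {y} r with reachIn G keep k u y in eq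
  ... | true  = stay (reachIn-elim P base stay step eq)
  ... | false with x , h ← any-allFin⁻ (λ w → reachIn G keep k u w ∧ adj G w y ∧ keep y) r =
    step (reachIn-elim P base stay step (BoolP.∧-conicalˡ (reachIn G keep k u x) _ h))
         (BoolP.∧-conicalˡ (adj G x y) _ (BoolP.∧-conicalʳ (reachIn G keep k u x) _ h))
         (BoolP.∧-conicalʳ (adj G x y) _ (BoolP.∧-conicalʳ (reachIn G keep k u x) _ h))

Lipschitz : ∀ {n} → Graph n → (Fin n → ℕ) → Set
Lipschitz G f = ∀ {x y} → adj G x y ≡ true → f y ≤ suc (f x)

module Distance {n : ℕ} (G : Graph n) where
  open Walks G allV

  Lipschitz⇒≤walk : ∀ {f u} → Lipschitz G f → f u ≡ 0 → ∀ {k w} → reach G k u w ≡ true → f w ≤ k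
  Lipschitz⇒≤walk {f} lip fu≡0 =
    reachIn-elim (λ k x → f x ≤ k) (ℕP.≤-reflexive fu≡0) ℕP.m≤n⇒m≤1+n
      (λ fx≤k a _ → ℕP.≤-trans (lip a) (s≤s fx≤k))

  distFrom-minimal : ∀ {u w j} fuel k → k ≤ j → reach G j u w ≡ true → distFrom G u w k fuel ≤ j
  distFrom-minimal zero k k≤j r = k≤j
  distFrom-minimal {u} {w} (suc fuel) k k≤j r with reach G k u w in eq
  ... | true  = k≤j
  ... | false = distFrom-minimal fuel (suc k) (ℕP.≤∧≢⇒< k≤j k≢j) r
    where
    k≢j : k ≢ _
    k≢j refl with () ← trans (≡.sym eq) r

  dist-minimal : ∀ {u w j} → reach G j u w ≡ true → dist G u w ≤ j
  dist-minimal = distFrom-minimal n 0 z≤n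

  distFrom-reach : ∀ {u w} fuel k → reach G (k + fuel) u w ≡ true → reach G (distFrom G u w k fuel) u w ≡ true
  distFrom-reach {u} {w} zero k r = subst (λ j → reach G j u w ≡ true) (ℕP.+-identityʳ k) r
  distFrom-reach {u} {w} (suc fuel) k r with reach G k u w in eq
  ... | true  = eq
  ... | false = distFrom-reach fuel (suc k) (subst (λ j → reach G j u w ≡ true) (ℕP.+-suc k fuel) r)

  dist-reach : Connected G → ∀ u w → reach G (dist G u w) u w ≡ true
  dist-reach con u w = distFrom-reach n 0 (con u w)

  dist-self : ∀ u → dist G u u ≡ 0
  dist-self u = ℕP.n≤0⇒n≡0 (dist-minimal (reachIn-refl refl))

  dist-Lipschitz : Connected G → ∀ u → Lipschitz G (dist G u)
  dist-Lipschitz con u {x} {y} a = dist-minimal (reachIn-step {dist G u x} {u} {x} {y} (dist-reach con u x) a refl)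

  Lipschitz⇒≤dist : Connected G → ∀ {f u} → Lipschitz G f → f u ≡ 0 → ∀ w → f w ≤ dist G u w
  Lipschitz⇒≤dist con lip fu≡0 w = Lipschitz⇒≤walk lip fu≡0 (dist-reach con _ w)

removed-all : ∀ n → removed {n} (λ _ → false) ≡ n
removed-all n = trans (removed≡∑ {n} (λ _ → false)) (trans (∑-const n 1) (ℕP.*-identityʳ n))

removed-none : ∀ n → removed {n} allV ≡ 0
removed-none n = trans (removed≡∑ {n} allV) (trans (∑-const n 0) (ℕP.*-zeroʳ n))

kept-witness : ∀ {n} (keep P : Fin n → Bool) → suc (removed keep) ≤ ∑[ w < n ] 𝟙 (P w) →
  ∃[ w ] P w ≡ true × keep w ≡ true
kept-witness {n} keep P removed<P with FinP.any? (λ w → P w ∧ keep w BoolP.≟ true)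
... | yes (w , h) = w , BoolP.∧-conicalˡ (P w) _ h , BoolP.∧-conicalʳ (P w) _ h
... | no none = ⊥-elim (ℕP.<⇒≱ removed<P (begin
  ∑[ w < n ] 𝟙 (P w)            ≤⟨ ∑-mono-≤ (λ w → 𝟙-mono (P⇒removed w)) ⟩
  ∑[ w < n ] 𝟙 (not (keep w))   ≡⟨ ≡.sym (removed≡∑ keep) ⟩
  removed keep                  ∎))
  where
  open ℕP.≤-Reasoning
  P⇒removed : ∀ w → P w ≡ true → not (keep w) ≡ true
  P⇒removed w Pw with keep w in kw
  ... | true  = ⊥-elim (none (w , cong₂ _∧_ Pw kw))
  ... | false = refl

KConnected⇒κ≤n : ∀ {n κ} {G : Graph n} → KConnected κ G → κ ≤ n
KConnected⇒κ≤n {n} {κ} kc with κ ℕP.≤? n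
... | yes κ≤n = κ≤n
... | no κ≰n
  with () ← proj₂ (proj₁ (kc (λ _ → false) (subst (λ r → suc r ≤ κ) (≡.sym (removed-all n)) (ℕP.≰⇒> κ≰n))))

-- Counting pairs of vertices

n+2*nC2≡n*n : ∀ n → n + 2 * (n C 2) ≡ n * n
n+2*nC2≡n*n zero    = refl
n+2*nC2≡n*n (suc n) = begin
  suc n + 2 * (suc n C 2)         ≡⟨ cong (λ c → suc n + 2 * c) (≡.sym (nCk+nC[k+1]≡[n+1]C[k+1] n 1)) ⟩
  suc n + 2 * (n C 1 + n C 2)     ≡⟨ cong (λ c → suc n + 2 * (c + n C 2)) (nC1≡n n) ⟩
  suc n + 2 * (n + n C 2)         ≡⟨ regroup n (n C 2) ⟩
  (n + 2 * (n C 2)) + (2 * n + 1) ≡⟨ cong (_+ (2 * n + 1)) (n+2*nC2≡n*n n) ⟩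
  n * n + (2 * n + 1)             ≡⟨ square n ⟩
  suc n * suc n                   ∎
  where
  open ≡-Reasoning
  regroup : ∀ n c → suc n + 2 * (n + c) ≡ (n + 2 * c) + (2 * n + 1)
  regroup = solve-∀
  square : ∀ n → n * n + (2 * n + 1) ≡ suc n * suc n
  square = solve-∀

[1+n]C2≡n+nC2 : ∀ n → suc n C 2 ≡ n + n C 2
[1+n]C2≡n+nC2 n = trans (≡.sym (nCk+nC[k+1]≡[n+1]C[k+1] n 1)) (cong (_+ n C 2) (nC1≡n n))

near : ℕ → ℕ → Bool
near a b = ⌊ a ≤? suc b ⌋ ∧ ⌊ b ≤? suc a ⌋

near-sym : ∀ a b → near a b ≡ near b a
near-sym a b = BoolP.∧-comm ⌊ a ≤? suc b ⌋ _

near-intro : ∀ {a b} → a ≤ suc b → b ≤ suc a → near a b ≡ true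
near-intro {a} {b} a≤1+b b≤1+a = cong₂ _∧_ (⌊⌋-true (a ≤? suc b) a≤1+b) (⌊⌋-true (b ≤? suc a) b≤1+a)

far-or-near : ∀ a b → 𝟙 ⌊ 2 + b ≤? a ⌋ + 𝟙 ⌊ 2 + a ≤? b ⌋ + 𝟙 (near a b) ≡ 1
far-or-near a b with a ≤? suc b | b ≤? suc a
... | yes a≤1+b | yes b≤1+a
  rewrite ⌊⌋-false (2 + b ≤? a) (λ b+1<a → ℕP.<⇒≱ b+1<a a≤1+b)
        | ⌊⌋-false (2 + a ≤? b) (λ a+1<b → ℕP.<⇒≱ a+1<b b≤1+a) = refl
... | no a≰1+b | _
  rewrite ⌊⌋-true (2 + b ≤? a) (ℕP.≰⇒> a≰1+b)
        | ⌊⌋-false (2 + a ≤? b) (λ a+1<b → a≰1+b (ℕP.≤-trans (ℕP.m≤n+m a 2) (ℕP.m≤n⇒m≤1+n a+1<b))) = refl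
... | yes _ | no b≰1+a
  rewrite ⌊⌋-false (2 + b ≤? a) (λ b+1<a → b≰1+a (ℕP.≤-trans (ℕP.m≤n+m b 2) (ℕP.m≤n⇒m≤1+n b+1<a)))
        | ⌊⌋-true (2 + a ≤? b) (ℕP.≰⇒> b≰1+a) = refl

module EdgeCount {n : ℕ} (G : Graph n) where

  degree : Fin n → ℕ
  degree i = ∑[ j < n ] 𝟙 (adj G i j)

  forward : Fin n → Fin n → ℕ
  forward i j = 𝟙 (⌊ i Fin.<? j ⌋ ∧ adj G i j)

  size≡∑forward : size G ≡ ∑[ i < n ] ∑[ j < n ] forward i j
  size≡∑forward = begin
    size G
      ≡⟨ length-filter-true (λ (i , j) → ⌊ i Fin.<? j ⌋ ∧ adj G i j) (concatMap row (allFin n)) ⟩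
    listSum (map (λ (i , j) → forward i j) (concatMap row (allFin n)))
      ≡⟨ listSum-concatMap _ row (allFin n) ⟩
    listSum (map (λ i → listSum (map (λ (i , j) → forward i j) (row i))) (allFin n))
      ≡⟨ listSum-map-allFin (λ i → listSum (map (λ (i , j) → forward i j) (row i))) ⟩
    ∑[ i < n ] listSum (map (λ (i , j) → forward i j) (row i))
      ≡⟨ sum-cong-≗ (λ i → trans (cong listSum (≡.sym (ListP.map-∘ (allFin n))))
                                 (listSum-map-allFin (forward i))) ⟩
    ∑[ i < n ] ∑[ j < n ] forward i j ∎
    where
    open ≡-Reasoning
    row : Fin n → List (Fin n × Fin n)
    row i = map (i ,_) (allFin n)

  𝟙adj≡forward+backward : ∀ i j → 𝟙 (adj G i j) ≡ forward i j + forward j i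
  𝟙adj≡forward+backward i j with FinP.<-cmp i j
  ... | tri< i<j _ j≮i rewrite ⌊⌋-true (i Fin.<? j) i<j | ⌊⌋-false (j Fin.<? i) j≮i =
    ≡.sym (ℕP.+-identityʳ _)
  ... | tri> i≮j _ j<i rewrite ⌊⌋-false (i Fin.<? j) i≮j | ⌊⌋-true (j Fin.<? i) j<i =
    cong 𝟙 (Graph.sym G i j)
  ... | tri≈ i≮i refl _ rewrite ⌊⌋-false (i Fin.<? i) i≮i | Graph.irrefl G i = refl

  handshake : ∑[ i < n ] degree i ≡ 2 * size G
  handshake = begin
    ∑[ i < n ] ∑[ j < n ] 𝟙 (adj G i j)
      ≡⟨ sum-cong-≗ (λ i → trans (sum-cong-≗ (𝟙adj≡forward+backward i)) (∑-distrib-+ (forward i) _)) ⟩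
    ∑[ i < n ] (∑[ j < n ] forward i j + ∑[ j < n ] forward j i)
      ≡⟨ ∑-distrib-+ (λ i → ∑[ j < n ] forward i j) _ ⟩
    ∑[ i < n ] ∑[ j < n ] forward i j + ∑[ i < n ] ∑[ j < n ] forward j i
      ≡⟨ cong (∑[ i < n ] ∑[ j < n ] forward i j +_) (∑-comm (λ i j → forward j i)) ⟩
    ∑[ i < n ] ∑[ j < n ] forward i j + ∑[ j < n ] ∑[ i < n ] forward j i
      ≡⟨ cong₂ _+_ (≡.sym size≡∑forward) (≡.sym size≡∑forward) ⟩
    size G + size G
      ≡⟨ cong (size G +_) (≡.sym (ℕP.+-identityʳ (size G))) ⟩
    2 * size G ∎
    where open ≡-Reasoning

module PairCount {n : ℕ} (G : Graph n) (f : Fin n → ℕ) where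
  open EdgeCount G

  farBelow : Fin n → Fin n → ℕ
  farBelow w u = 𝟙 ⌊ 2 + f u ≤? f w ⌋

  below : Fin n → ℕ
  below w = ∑[ u < n ] farBelow w u

  linkage : Fin n → Fin n → ℕ
  linkage w u = farBelow w u + farBelow u w + 𝟙 (adj G w u)

  ∑linkage : ∑[ w < n ] ∑[ u < n ] linkage w u ≡ 2 * (∑[ w < n ] below w + size G)
  ∑linkage = begin
    ∑[ w < n ] ∑[ u < n ] linkage w u
      ≡⟨ sum-cong-≗ (λ w → trans (∑-distrib-+ (λ u → farBelow w u + farBelow u w) _)
                                 (cong (_+ degree w) (∑-distrib-+ (farBelow w) _))) ⟩
    ∑[ w < n ] (below w + ∑[ u < n ] farBelow u w + degree w)
      ≡⟨ ∑-distrib-+ (λ w → below w + ∑[ u < n ] farBelow u w) degree ⟩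
    ∑[ w < n ] (below w + ∑[ u < n ] farBelow u w) + ∑[ w < n ] degree w
      ≡⟨ cong₂ _+_ (trans (∑-distrib-+ below _) (cong (∑[ w < n ] below w +_) (∑-comm (λ w u → farBelow u w))))
                   handshake ⟩
    (∑[ w < n ] below w + ∑[ u < n ] below u) + 2 * size G
      ≡⟨ double (∑[ w < n ] below w) (size G) ⟩
    2 * (∑[ w < n ] below w + size G) ∎
    where
    open ≡-Reasoning
    double : ∀ b m → b + b + 2 * m ≡ 2 * (b + m)
    double = solve-∀

  linkage-self : ∀ w → linkage w w ≡ 0
  linkage-self w rewrite ⌊⌋-false (2 + f w ≤? f w) (λ fw+1<fw → ℕP.<⇒≱ fw+1<fw (ℕP.n≤1+n (f w)))
                       | Graph.irrefl G w = refl

  linkage≡1 : ∀ w u → 𝟙 (adj G w u) ≡ 𝟙 (near (f w) (f u)) → linkage w u ≡ 1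
  linkage≡1 w u h = trans (cong (farBelow w u + farBelow u w +_) h) (far-or-near (f w) (f u))

  linkage≤1 : Lipschitz G f → ∀ w u → linkage w u ≤ 1
  linkage≤1 lip w u = ℕP.≤-trans (ℕP.+-monoʳ-≤ (farBelow w u + farBelow u w) (𝟙-mono adj⇒near))
                                 (ℕP.≤-reflexive (far-or-near (f w) (f u)))
    where
    adj⇒near : adj G w u ≡ true → near (f w) (f u) ≡ true
    adj⇒near a = cong₂ _∧_ (⌊⌋-true (f w ≤? suc (f u)) (lip (trans (Graph.sym G u w) a)))
                            (⌊⌋-true (f u ≤? suc (f w)) (lip a))

  private
    ∑rows : ∑[ w < n ] suc (∑[ u < n ] linkage w u) ≡ n + 2 * (∑[ w < n ] below w + size G)
    ∑rows = trans (∑-distrib-+ (λ _ → 1) (λ w → ∑[ u < n ] linkage w u))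
                  (cong₂ _+_ (trans (∑-const n 1) (ℕP.*-identityʳ n)) ∑linkage)

  ∑below+size≤nC2 : Lipschitz G f → ∑[ w < n ] below w + size G ≤ n C 2
  ∑below+size≤nC2 lip = ℕP.*-cancelˡ-≤ 2 (ℕP.+-cancelˡ-≤ n _ _ (begin
    n + 2 * (∑[ w < n ] below w + size G)    ≡⟨ ≡.sym ∑rows ⟩
    ∑[ w < n ] suc (∑[ u < n ] linkage w u)  ≤⟨ ∑-mono-≤ (λ w → ∑<n (linkage w) w (linkage≤1 lip w) (linkage-self w)) ⟩
    ∑[ w < n ] n                             ≡⟨ ∑-const n n ⟩
    n * n                                    ≡⟨ ≡.sym (n+2*nC2≡n*n n) ⟩
    n + 2 * (n C 2)                          ∎))
    where open ℕP.≤-Reasoning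

  ∑below+size≡nC2 : (∀ w u → u ≢ w → adj G w u ≡ near (f w) (f u)) → ∑[ w < n ] below w + size G ≡ n C 2
  ∑below+size≡nC2 adj≡near = ℕP.*-cancelˡ-≡ _ _ 2 (ℕP.+-cancelˡ-≡ n _ _ (begin
    n + 2 * (∑[ w < n ] below w + size G)    ≡⟨ ≡.sym ∑rows ⟩
    ∑[ w < n ] suc (∑[ u < n ] linkage w u)  ≡⟨ sum-cong-≗ row≡n ⟩
    ∑[ w < n ] n                             ≡⟨ ∑-const n n ⟩
    n * n                                    ≡⟨ ≡.sym (n+2*nC2≡n*n n) ⟩
    n + 2 * (n C 2)                          ∎))
    where
    open ≡-Reasoning
    row≡n : ∀ w → suc (∑[ u < n ] linkage w u) ≡ n
    row≡n w = ∑-ones-but-one (linkage w) w (linkage-self w)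
                (λ u u≢w → linkage≡1 w u (cong 𝟙 (adj≡near w u u≢w)))

-- Layers around a vertex

𝟙≤suc : ∀ a t → 𝟙 ⌊ a ≤? suc t ⌋ ≡ 𝟙 ⌊ a ≤? t ⌋ + 𝟙 ⌊ a ℕ.≟ suc t ⌋
𝟙≤suc a t with a ≤? t
... | yes a≤t rewrite ⌊⌋-true (a ≤? suc t) (ℕP.m≤n⇒m≤1+n a≤t)
                    | ⌊⌋-false (a ℕ.≟ suc t) (λ a≡1+t → ℕP.<-irrefl a≡1+t (s≤s a≤t)) = refl
... | no a≰t with a ℕ.≟ suc t
...   | yes a≡1+t rewrite ⌊⌋-true (a ≤? suc t) (ℕP.≤-reflexive a≡1+t) = refl
...   | no a≢1+t rewrite ⌊⌋-false (a ≤? suc t) (λ a≤1+t → a≢1+t (ℕP.≤-antisym a≤1+t (ℕP.≰⇒> a≰t))) = refl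

module Layers {n : ℕ} {G : Graph n} (con : Connected G) (v : Fin n) where
  open Distance G

  d : Fin n → ℕ
  d = dist G v

  layer : ℕ → ℕ
  layer i = ∑[ u < n ] 𝟙 ⌊ d u ℕ.≟ i ⌋

  ball : ℕ → ℕ
  ball t = ∑[ u < n ] 𝟙 ⌊ d u ≤? t ⌋

  κ≤layer : ∀ {κ} → KConnected κ G → ∀ {i w} → 0 < i → i < d w → κ ≤ layer i
  κ≤layer {κ} kc {i} {w} 0<i i<dw with κ ℕP.≤? layer i
  ... | yes κ≤layer = κ≤layer
  ... | no κ≰layer =
    ⊥-elim (ℕP.<-asym (stays-below {n} (proj₂ (kc off-layer removed<κ) v w (kept v≢i) (kept w≢i))) i<dw)
    where
    off-layer : Fin n → Bool
    off-layer u = not ⌊ d u ℕ.≟ i ⌋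

    removed<κ : suc (removed off-layer) ≤ κ
    removed<κ = subst (λ r → suc r ≤ κ)
      (≡.sym (trans (removed≡∑ off-layer) (sum-cong-≗ (λ u → cong 𝟙 (BoolP.not-involutive ⌊ d u ℕ.≟ i ⌋)))))
      (ℕP.≰⇒> κ≰layer)

    kept : ∀ {u} → d u ≢ i → off-layer u ≡ true
    kept {u} du≢i = cong not (⌊⌋-false (d u ℕ.≟ i) du≢i)

    kept⁻ : ∀ {u} → off-layer u ≡ true → d u ≢ i
    kept⁻ {u} ku du≡i with () ← trans (≡.sym ku) (cong not (⌊⌋-true (d u ℕ.≟ i) du≡i))

    v≢i : d v ≢ i
    v≢i dv≡i = ℕP.<-irrefl (trans (≡.sym (dist-self v)) dv≡i) 0<i

    w≢i : d w ≢ i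
    w≢i dw≡i = ℕP.<-irrefl (≡.sym dw≡i) i<dw

    stays-below : ∀ {k x} → reachIn G off-layer k v x ≡ true → d x < i
    stays-below {k} {x} = Walks.reachIn-elim G off-layer (λ _ x → d x < i)
      (subst (_< i) (≡.sym (dist-self v)) 0<i) id
      (λ dx<i a ky → ℕP.≤∧≢⇒< (ℕP.≤-trans (dist-Lipschitz con v a) dx<i) (kept⁻ ky)) {k} {x}

  ball-growth : ∀ {κ} → KConnected κ G → ∀ {t w} → suc t < d w → 1 + t * κ ≤ ball t
  ball-growth kc {zero} _ = ℕP.≤-trans (ℕP.≤-reflexive (cong 𝟙 (≡.sym v∈ball₀))) (term≤∑ _ v)
    where
    v∈ball₀ : ⌊ d v ≤? 0 ⌋ ≡ true
    v∈ball₀ = ⌊⌋-true (d v ≤? 0) (ℕP.≤-reflexive (dist-self v))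
  ball-growth {κ} kc {suc t} {w} 2+t<dw = begin
    1 + suc t * κ            ≡⟨ regroup t κ ⟩
    (1 + t * κ) + κ          ≤⟨ ℕP.+-mono-≤ (ball-growth kc (ℕP.<-trans (ℕP.n<1+n _) 2+t<dw))
                                            (κ≤layer kc (s≤s z≤n) (ℕP.<-trans (ℕP.n<1+n _) 2+t<dw)) ⟩
    ball t + layer (suc t)   ≡⟨ ≡.sym (∑-distrib-+ (λ u → 𝟙 ⌊ d u ≤? t ⌋) _) ⟩
    ∑[ u < n ] (𝟙 ⌊ d u ≤? t ⌋ + 𝟙 ⌊ d u ℕ.≟ suc t ⌋) ≡⟨ sum-cong-≗ (λ u → ≡.sym (𝟙≤suc (d u) t)) ⟩
    ball (suc t)             ∎
    where
    open ℕP.≤-Reasoning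
    regroup : ∀ t κ → 1 + suc t * κ ≡ (1 + t * κ) + κ
    regroup = solve-∀

  open PairCount G d public using (below)

  below≡ball : ∀ {w t} → d w ≡ suc (suc t) → below w ≡ ball t
  below≡ball {w} {t} dw≡2+t =
    sum-cong-≗ (λ u → cong 𝟙 (trans (cong (λ a → ⌊ 2 + d u ≤? a ⌋) dw≡2+t)
                                     (⌊⌋-⇔ (mk⇔ (ℕ.s≤s⁻¹ ∘ ℕ.s≤s⁻¹) (s≤s ∘ s≤s)) (2 + d u ≤? 2 + t) (d u ≤? t))))

  vertex-bound : ∀ {k} → KConnected (suc k) G → ∀ w →
    d w * suc k + 𝟙 ⌊ d w ℕ.≟ 1 ⌋ * k ≤ below w + 𝟙 ⌊ 1 ≤? d w ⌋ * (2 * k + 1)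
  vertex-bound {k} kc w = by-distance (d w) refl
    where
    by-distance : ∀ a → d w ≡ a → a * suc k + 𝟙 ⌊ a ℕ.≟ 1 ⌋ * k ≤ below w + 𝟙 ⌊ 1 ≤? a ⌋ * (2 * k + 1)
    by-distance zero          _       = z≤n
    by-distance 1             _       =
      ℕP.≤-trans (ℕP.≤-reflexive (first-layer k)) (ℕP.m≤n+m _ (below w))
      where
      first-layer : ∀ k → 1 * suc k + 1 * k ≡ 1 * (2 * k + 1)
      first-layer = solve-∀
    by-distance (suc (suc t)) dw≡2+t = begin
      (2 + t) * suc k + 0 * k          ≡⟨ regroup t k ⟩
      (1 + t * suc k) + 1 * (2 * k + 1) ≤⟨ ℕP.+-monoˡ-≤ _ (ball-growth kc (ℕP.≤-reflexive (≡.sym dw≡2+t))) ⟩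
      ball t + 1 * (2 * k + 1)          ≡⟨ cong (_+ 1 * (2 * k + 1)) (≡.sym (below≡ball dw≡2+t)) ⟩
      below w + 1 * (2 * k + 1)         ∎
      where
      open ℕP.≤-Reasoning
      regroup : ∀ t k → (2 + t) * suc k + 0 * k ≡ (1 + t * suc k) + 1 * (2 * k + 1)
      regroup = solve-∀

  transmission-layer-bound : ∀ {k} → KConnected (suc k) G →
    sum d * suc k + layer 1 * k ≤ ∑[ w < n ] below w + (∑[ w < n ] 𝟙 ⌊ 1 ≤? d w ⌋) * (2 * k + 1)
  transmission-layer-bound {k} kc = begin
    sum d * suc k + layer 1 * k
      ≡⟨ cong₂ _+_ (*-distribʳ-sum (suc k) d) (*-distribʳ-sum k (λ w → 𝟙 ⌊ d w ℕ.≟ 1 ⌋)) ⟩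
    ∑[ w < n ] (d w * suc k) + ∑[ w < n ] (𝟙 ⌊ d w ℕ.≟ 1 ⌋ * k)
      ≡⟨ ≡.sym (∑-distrib-+ (λ w → d w * suc k) _) ⟩
    ∑[ w < n ] (d w * suc k + 𝟙 ⌊ d w ℕ.≟ 1 ⌋ * k)
      ≤⟨ ∑-mono-≤ (vertex-bound kc) ⟩
    ∑[ w < n ] (below w + 𝟙 ⌊ 1 ≤? d w ⌋ * (2 * k + 1))
      ≡⟨ ∑-distrib-+ below _ ⟩
    ∑[ w < n ] below w + ∑[ w < n ] (𝟙 ⌊ 1 ≤? d w ⌋ * (2 * k + 1))
      ≡⟨ cong (∑[ w < n ] below w +_) (≡.sym (*-distribʳ-sum (2 * k + 1) (λ w → 𝟙 ⌊ 1 ≤? d w ⌋))) ⟩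
    ∑[ w < n ] below w + (∑[ w < n ] 𝟙 ⌊ 1 ≤? d w ⌋) * (2 * k + 1) ∎
    where open ℕP.≤-Reasoning

  off-centre : ∑[ w < n ] 𝟙 ⌊ 1 ≤? d w ⌋ < n
  off-centre = ∑<n _ v (λ w → 𝟙≤1 _) (cong (λ a → 𝟙 ⌊ 1 ≤? a ⌋) (dist-self v))

-- The upper bound

layered-arithmetic : ∀ {σ k L T S D m c} →
  σ * suc k + L * k ≤ T + S * (2 * k + 1) → S < suc D → T + m ≤ D + c → suc k ≤ L →
  m + (σ + k) * suc k ≤ c + 2 * D * suc k
layered-arithmetic {σ} {k} {L} {T} {S} {D} {m} {c} layers off-centre pairs first-layer = begin
  m + (σ + k) * suc k         ≡⟨ e₁ σ k m ⟩
  σ * suc k + suc k * k + m   ≤⟨ ℕP.+-monoˡ-≤ m (ℕP.+-monoʳ-≤ (σ * suc k) (ℕP.*-monoˡ-≤ k first-layer)) ⟩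
  σ * suc k + L * k + m       ≤⟨ ℕP.+-monoˡ-≤ m layers ⟩
  T + S * (2 * k + 1) + m     ≡⟨ e₂ T (S * (2 * k + 1)) m ⟩
  (T + m) + S * (2 * k + 1)   ≤⟨ ℕP.+-mono-≤ pairs (ℕP.*-monoˡ-≤ (2 * k + 1) (ℕ.s≤s⁻¹ off-centre)) ⟩
  (D + c) + D * (2 * k + 1)   ≡⟨ e₃ D c k ⟩
  c + 2 * D * suc k           ∎
  where
  open ℕP.≤-Reasoning
  e₁ : ∀ σ k m → m + (σ + k) * suc k ≡ σ * suc k + suc k * k + m
  e₁ = solve-∀
  e₂ : ∀ T x m → T + x + m ≡ (T + m) + x
  e₂ = solve-∀
  e₃ : ∀ D c k → (D + c) + D * (2 * k + 1) ≡ c + 2 * D * suc k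
  e₃ = solve-∀

star-arithmetic : ∀ {σ k D m c} → σ ≤ D → k ≤ D → m ≤ c → m + (σ + k) * suc k ≤ c + 2 * D * suc k
star-arithmetic {σ} {k} {D} {m} {c} σ≤D k≤D m≤c = begin
  m + (σ + k) * suc k   ≤⟨ ℕP.+-mono-≤ m≤c (ℕP.*-monoˡ-≤ (suc k) (ℕP.+-mono-≤ σ≤D k≤D)) ⟩
  c + (D + D) * suc k   ≡⟨ e D k c ⟩
  c + 2 * D * suc k     ∎
  where
  open ℕP.≤-Reasoning
  e : ∀ D k c → c + (D + D) * suc k ≡ c + 2 * D * suc k
  e = solve-∀

transmission≡∑ : ∀ {n} (G : Graph n) v → transmission G v ≡ ∑[ w < n ] dist G v w
transmission≡∑ G v = listSum-map-allFin (dist G v)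

transmission-bound : ∀ {D k} {G : Graph (suc D)} → Connected G → KConnected (suc k) G → size G ≤ D C 2 →
  ∀ v → size G + (transmission G v + k) * suc k ≤ D C 2 + 2 * D * suc k
transmission-bound {D} {k} {G} con kc m≤C v
  rewrite transmission≡∑ G v = by-eccentricity (FinP.any? (λ w → 2 ≤? d w))
  where
  open Layers con v

  by-eccentricity : Dec (∃[ w ] 2 ≤ d w) → size G + (sum d + k) * suc k ≤ D C 2 + 2 * D * suc k
  by-eccentricity (yes (w , 2≤dw)) = layered-arithmetic {σ = sum d} (transmission-layer-bound kc) off-centre
    (subst (∑[ w < suc D ] below w + size G ≤_) ([1+n]C2≡n+nC2 D)
           (PairCount.∑below+size≤nC2 G d (Distance.dist-Lipschitz G con v)))
    (κ≤layer kc (s≤s z≤n) 2≤dw)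
  by-eccentricity (no ∄far) = star-arithmetic {σ = sum d} σ≤D (ℕP.≤-pred (KConnected⇒κ≤n kc)) m≤C
    where
    σ≤D : sum d ≤ D
    σ≤D = ℕ.s≤s⁻¹ (∑<n d v (λ w → ℕP.≤-pred (ℕP.≰⇒> (λ 2≤dw → ∄far (w , 2≤dw)))) (Distance.dist-self G v))

same-residue : ∀ {κ} .{{_ : NonZero κ}} {m a c b} → m + a * κ ≡ c + b * κ → m % κ ≡ c % κ
same-residue {κ} {m} {a} {c} {b} eq =
  trans (≡.sym ([m+kn]%n≡m%n m a κ)) (trans (cong (_% κ) eq) ([m+kn]%n≡m%n c b κ))

least-in-class : ∀ {κ} .{{_ : NonZero κ}} {m m* a c b} → m + a * κ ≤ c + b * κ →
  (∀ m′ → m ≤ m′ → m′ % κ ≡ c % κ → m* ≤ m′) → m* + a * κ ≤ c + b * κ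
least-in-class {κ} {m} {m*} {a} {c} {b} m+aκ≤c+bκ least =
  ℕP.m≤o∸n⇒m+n≤o m* aκ≤c+bκ
    (least m′ (ℕP.m+n≤o⇒m≤o∸n m m+aκ≤c+bκ) (same-residue {m = m′} {a} {c} {b} m′+aκ≡c+bκ))
  where
  aκ≤c+bκ : a * κ ≤ c + b * κ
  aκ≤c+bκ = ℕP.≤-trans (ℕP.m≤n+m (a * κ) m) m+aκ≤c+bκ
  m′ : ℕ
  m′ = c + b * κ ∸ a * κ
  m′+aκ≡c+bκ : m′ + a * κ ≡ c + b * κ
  m′+aκ≡c+bκ = ℕP.m∸n+n≡m aκ≤c+bκ

fracᵘ : ℕ → ℕ → ℚᵘ
fracᵘ a zero    = ℚᵘ.0ℚᵘ
fracᵘ a (suc d) = mkℚᵘ (ℤ.+ a) d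

boundᵘ : (κ n mstar : ℕ) → ℚᵘ
boundᵘ κ n mstar =
  fracᵘ n (2 * κ) ℚᵘ.+ fracᵘ 2 1 ℚᵘ.- fracᵘ 1 κ ℚᵘ.- fracᵘ (κ ∸ 1) (n ∸ 1)
    ℚᵘ.- fracᵘ mstar (κ * (n ∸ 1))

toℚᵘ-frac : ∀ a d → toℚᵘ (frac a d) ≃ fracᵘ a d
toℚᵘ-frac a zero    = ℚᵘP.≃-refl
toℚᵘ-frac a (suc d) = ℚP.toℚᵘ-fromℚᵘ (mkℚᵘ (ℤ.+ a) d)

toℚᵘ-+ : ∀ {p q P Q} → toℚᵘ p ≃ P → toℚᵘ q ≃ Q → toℚᵘ (p ℚ.+ q) ≃ P ℚᵘ.+ Q
toℚᵘ-+ {p} {q} p≃P q≃Q = ℚᵘP.≃-trans (ℚP.toℚᵘ-homo-+ p q) (ℚᵘP.+-cong p≃P q≃Q)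

toℚᵘ-- : ∀ {p q P Q} → toℚᵘ p ≃ P → toℚᵘ q ≃ Q → toℚᵘ (p ℚ.- q) ≃ P ℚᵘ.- Q
toℚᵘ-- {p} {q} p≃P q≃Q =
  toℚᵘ-+ {p} {ℚ.- q} p≃P (ℚᵘP.≃-trans (ℚP.toℚᵘ-homo‿- q) (ℚᵘP.-‿cong q≃Q))

toℚᵘ-bound : ∀ κ n mstar → toℚᵘ (bound κ n mstar) ≃ boundᵘ κ n mstar
toℚᵘ-bound κ n mstar =
  toℚᵘ-- (toℚᵘ-- (toℚᵘ-- (toℚᵘ-+ (toℚᵘ-frac n (2 * κ)) (toℚᵘ-frac 2 1)) (toℚᵘ-frac 1 κ))
                 (toℚᵘ-frac (κ ∸ 1) (n ∸ 1)))
         (toℚᵘ-frac mstar (κ * (n ∸ 1)))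

-- num and den are what ℚᵘ arithmetic computes as numerator and denominator of
-- boundᵘ (1 + k) (2 + t) m, so the identity applies to it by conversion.
boundᵘ-cross : ∀ (k t m s δ : ℤ) →
  let K   = ℤ.+ 1 ℤ.+ k
      D   = ℤ.+ 1 ℤ.+ t
      P   = ℤ.+ 2 ℤ.* (m ℤ.+ (s ℤ.+ k) ℤ.* K) ℤ.+ D
      Q   = D ℤ.* D ℤ.+ ℤ.+ 4 ℤ.* D ℤ.* K
      num = ((((ℤ.+ 1 ℤ.+ D) ℤ.* ℤ.+ 1 ℤ.+ ℤ.+ 2 ℤ.* (ℤ.+ 2 ℤ.* K)) ℤ.* K
               ℤ.+ (ℤ.- ℤ.+ 1) ℤ.* (ℤ.+ 2 ℤ.* K ℤ.* ℤ.+ 1)) ℤ.* D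
               ℤ.+ (ℤ.- k) ℤ.* (ℤ.+ 2 ℤ.* K ℤ.* ℤ.+ 1 ℤ.* K)) ℤ.* (K ℤ.* D)
            ℤ.+ (ℤ.- m) ℤ.* (ℤ.+ 2 ℤ.* K ℤ.* ℤ.+ 1 ℤ.* K ℤ.* D)
      den = ℤ.+ 2 ℤ.* K ℤ.* ℤ.+ 1 ℤ.* K ℤ.* D ℤ.* (K ℤ.* D)
  in num ℤ.* (D ℤ.* (K ℤ.* D))
       ℤ.+ (ℤ.+ 2 ℤ.* δ ℤ.- (Q ℤ.- P)) ℤ.* (D ℤ.* (K ℤ.* K ℤ.* D ℤ.* (K ℤ.* D)))
     ≡ (s ℤ.* (K ℤ.* D) ℤ.+ δ ℤ.* D) ℤ.* den
boundᵘ-cross = ℤ-Solver.solve-∀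

boundᵘ-split : ∀ k t m σ δ →
  2 * δ + (2 * (m + (σ + k) * suc k) + suc t) ≡ suc t * suc t + 4 * suc t * suc k →
  boundᵘ (suc k) (2 + t) m ≃ fracᵘ σ (suc t) ℚᵘ.+ fracᵘ δ (suc k * suc t)
boundᵘ-split k t m σ δ eq = *≡* (begin
  ℚᵘ.↥ B ℤ.* ℚᵘ.↧ R
    ≡⟨ ≡.sym (ℤP.+-identityʳ _) ⟩
  ℚᵘ.↥ B ℤ.* ℚᵘ.↧ R ℤ.+ ℤ.0ℤ ℤ.* W
    ≡⟨ cong (λ e → ℚᵘ.↥ B ℤ.* ℚᵘ.↧ R ℤ.+ e ℤ.* W) (≡.sym excess≡0) ⟩
  ℚᵘ.↥ B ℤ.* ℚᵘ.↧ R ℤ.+ (ℤ.+ 2 ℤ.* ℤ.+ δ ℤ.- (Qz ℤ.- Pz)) ℤ.* W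
    ≡⟨ boundᵘ-cross (ℤ.+ k) (ℤ.+ t) (ℤ.+ m) (ℤ.+ σ) (ℤ.+ δ) ⟩
  ℚᵘ.↥ R ℤ.* ℚᵘ.↧ B ∎)
  where
  open ≡-Reasoning
  B = boundᵘ (suc k) (2 + t) m
  R = fracᵘ σ (suc t) ℚᵘ.+ fracᵘ δ (suc k * suc t)
  K = ℤ.+ suc k
  D = ℤ.+ suc t
  W = D ℤ.* (K ℤ.* K ℤ.* D ℤ.* (K ℤ.* D))
  Pz = ℤ.+ 2 ℤ.* (ℤ.+ m ℤ.+ (ℤ.+ σ ℤ.+ ℤ.+ k) ℤ.* K) ℤ.+ D
  Qz = D ℤ.* D ℤ.+ ℤ.+ 4 ℤ.* D ℤ.* K

  castL : ℤ.+ (2 * δ + (2 * (m + (σ + k) * suc k) + suc t)) ≡ ℤ.+ 2 ℤ.* ℤ.+ δ ℤ.+ Pz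
  castL = trans (ℤP.pos-+ (2 * δ) _) (cong₂ ℤ._+_ (ℤP.pos-* 2 δ)
    (trans (ℤP.pos-+ (2 * (m + (σ + k) * suc k)) (suc t)) (cong (ℤ._+ D)
      (trans (ℤP.pos-* 2 (m + (σ + k) * suc k)) (cong (ℤ.+ 2 ℤ.*_)
        (trans (ℤP.pos-+ m ((σ + k) * suc k)) (cong (ℤ._+_ (ℤ.+ m))
          (trans (ℤP.pos-* (σ + k) (suc k)) (cong (ℤ._* K) (ℤP.pos-+ σ k))))))))))

  castR : ℤ.+ (suc t * suc t + 4 * suc t * suc k) ≡ Qz
  castR = trans (ℤP.pos-+ (suc t * suc t) (4 * suc t * suc k)) (cong₂ ℤ._+_ (ℤP.pos-* (suc t) (suc t))
    (trans (ℤP.pos-* (4 * suc t) (suc k)) (cong (ℤ._* K) (ℤP.pos-* 4 (suc t)))))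

  rearrange : ∀ a p q → a ℤ.- (q ℤ.- p) ≡ (a ℤ.+ p) ℤ.- q
  rearrange = ℤ-Solver.solve-∀

  excess≡0 : ℤ.+ 2 ℤ.* ℤ.+ δ ℤ.- (Qz ℤ.- Pz) ≡ ℤ.0ℤ
  excess≡0 = begin
    ℤ.+ 2 ℤ.* ℤ.+ δ ℤ.- (Qz ℤ.- Pz) ≡⟨ rearrange (ℤ.+ 2 ℤ.* ℤ.+ δ) Pz Qz ⟩
    (ℤ.+ 2 ℤ.* ℤ.+ δ ℤ.+ Pz) ℤ.- Qz ≡⟨ cong (ℤ._- Qz) (trans (≡.sym castL) (trans (cong ℤ.+_ eq) castR)) ⟩
    Qz ℤ.- Qz                       ≡⟨ ℤP.+-inverseʳ Qz ⟩
    ℤ.0ℤ                            ∎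

bound-split : ∀ {k t m σ δ} → m + (σ + k) * suc k + δ ≡ suc t C 2 + 2 * suc t * suc k →
  bound (suc k) (2 + t) m ≡ frac σ (suc t) ℚ.+ frac δ (suc k * suc t)
bound-split {k} {t} {m} {σ} {δ} eq = ℚP.toℚᵘ-injective (begin
  toℚᵘ (bound (suc k) (2 + t) m)
    ≈⟨ toℚᵘ-bound (suc k) (2 + t) m ⟩
  boundᵘ (suc k) (2 + t) m
    ≈⟨ boundᵘ-split k t m σ δ doubled ⟩
  fracᵘ σ (suc t) ℚᵘ.+ fracᵘ δ (suc k * suc t)
    ≈⟨ ℚᵘP.≃-sym (toℚᵘ-+ (toℚᵘ-frac σ (suc t)) (toℚᵘ-frac δ (suc k * suc t))) ⟩
  toℚᵘ (frac σ (suc t) ℚ.+ frac δ (suc k * suc t)) ∎)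
  where
  open ℚᵘP.≃-Reasoning
  e₁ : ∀ δ m σ k t → 2 * δ + (2 * (m + (σ + k) * suc k) + suc t) ≡ 2 * (m + (σ + k) * suc k + δ) + suc t
  e₁ = solve-∀
  e₂ : ∀ c t k → 2 * (c + 2 * suc t * suc k) + suc t ≡ (suc t + 2 * c) + 4 * suc t * suc k
  e₂ = solve-∀
  doubled : 2 * δ + (2 * (m + (σ + k) * suc k) + suc t) ≡ suc t * suc t + 4 * suc t * suc k
  doubled = trans (e₁ δ m σ k t) (trans (cong (λ x → 2 * x + suc t) eq)
              (trans (e₂ (suc t C 2) t k) (cong (_+ 4 * suc t * suc k) (n+2*nC2≡n*n (suc t)))))

0≤frac : ∀ a d → ℚ.0ℚ ℚ.≤ frac a d
0≤frac a zero    = ℚP.≤-refl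
0≤frac a (suc d) = ℚP.nonNegative⁻¹ (frac a (suc d)) {{ℚP.normalize-nonNeg a (suc d)}}

meanDist≤bound : ∀ {k t mstar} {G : Graph (2 + t)} → Connected G → KConnected (suc k) G → size G ≤ suc t C 2 →
  (∀ m′ → size G ≤ m′ → m′ % suc k ≡ (suc t C 2) % suc k → mstar ≤ m′) →
  ∀ v → meanDist G v ℚ.≤ bound (suc k) (2 + t) mstar
meanDist≤bound {k} {t} {mstar} {G} con kc m≤C least v = begin
  frac σ (suc t)                              ≡⟨ ≡.sym (ℚP.+-identityʳ _) ⟩
  frac σ (suc t) ℚ.+ ℚ.0ℚ                     ≤⟨ ℚP.+-monoʳ-≤ (frac σ (suc t)) (0≤frac δ (suc k * suc t)) ⟩
  frac σ (suc t) ℚ.+ frac δ (suc k * suc t)   ≡⟨ ≡.sym (bound-split {k} {t} {mstar} {σ} {δ} mstar+gap) ⟩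
  bound (suc k) (2 + t) mstar                 ∎
  where
  open ℚP.≤-Reasoning
  σ = transmission G v
  mstar-bound : mstar + (σ + k) * suc k ≤ suc t C 2 + 2 * suc t * suc k
  mstar-bound = least-in-class {a = σ + k} {c = suc t C 2} {b = 2 * suc t} (transmission-bound con kc m≤C v) least
  δ = suc t C 2 + 2 * suc t * suc k ∸ (mstar + (σ + k) * suc k)
  mstar+gap : mstar + (σ + k) * suc k + δ ≡ suc t C 2 + 2 * suc t * suc k
  mstar+gap = ℕP.m+[n∸m]≡n mstar-bound

remoteness≤ : ∀ {n} (G : Graph n) {b} → ℚ.0ℚ ℚ.≤ b → (∀ v → meanDist G v ℚ.≤ b) → remoteness G ℚ.≤ b
remoteness≤ {n} G {b} 0≤b mean≤b = lub (allFin n)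
  where
  lub : ∀ vs → foldr (λ v r → meanDist G v ℚ.⊔ r) ℚ.0ℚ vs ℚ.≤ b
  lub []       = 0≤b
  lub (v ∷ vs) = ℚP.⊔-lub (mean≤b v) (lub vs)

remoteness-upper-bound : ∀ (κ n : ℕ) .{{_ : NonZero κ}} (G : Graph n) (b mstar : ℕ) →
  n ≥ 2 → Connected G → KConnected κ G →
  IsB κ n b → SizeRange κ n b (size G) → IsMStar κ n (size G) mstar →
  remoteness G ≤ℚ bound κ n mstar
remoteness-upper-bound (suc k) (suc (suc t)) G _ mstar (s≤s (s≤s z≤n)) con kc _ (_ , m≤C) (_ , _ , least) =
  remoteness≤ G (ℚP.≤-trans (0≤frac (transmission G Fin.zero) (suc t)) (mean≤bound Fin.zero)) mean≤bound
  where
  mean≤bound = meanDist≤bound con kc m≤C least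

-- Sharpness

module LayeredGraph {n : ℕ} (level : Fin n → ℕ) where

  adjacent : Fin n → Fin n → Bool
  adjacent a b = not ⌊ a Fin.≟ b ⌋ ∧ near (level a) (level b)

  graph : Graph n
  graph = record
    { adj    = adjacent
    ; sym    = λ a b → cong₂ _∧_ (cong not (⌊⌋-⇔ (mk⇔ ≡.sym ≡.sym) (a Fin.≟ b) (b Fin.≟ a)))
                                 (near-sym (level a) (level b))
    ; irrefl = λ a → cong (λ x → not x ∧ near (level a) (level a)) (⌊⌋-true (a Fin.≟ a) refl)
    }

  adjacent≡near : ∀ a b → b ≢ a → adjacent a b ≡ near (level a) (level b)
  adjacent≡near a b b≢a = cong (λ x → not x ∧ near (level a) (level b)) (⌊⌋-false (a Fin.≟ b) (b≢a ∘ ≡.sym))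

  level-Lipschitz : Lipschitz graph level
  level-Lipschitz {x} {y} a with x Fin.≟ y
  ... | yes _ with () ← a
  ... | no _  = ⌊⌋-true⁻ (level y ≤? suc (level x)) (BoolP.∧-conicalʳ _ _ a)

  reachIn-near : ∀ {keep k u x y} → reachIn graph keep k u x ≡ true → near (level x) (level y) ≡ true →
                 keep y ≡ true → reachIn graph keep (suc k) u y ≡ true
  reachIn-near {keep} {k} {u} {x} {y} r nr ky with x Fin.≟ y
  ... | yes refl = Walks.reachIn-suc graph keep {k} {u} {x} r
  ... | no x≢y   = Walks.reachIn-step graph keep {k} {u} {x} {y} r
                     (trans (adjacent≡near x y (x≢y ∘ ≡.sym)) nr) ky

  consecutive : ∀ {x w l} → level x ≡ l → level w ≡ suc l → near (level x) (level w) ≡ true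
  consecutive {x} refl lw≡1+lx rewrite lw≡1+lx = near-intro {level x} (ℕP.m≤n⇒m≤1+n (ℕP.n≤1+n _)) ℕP.≤-refl

  dist≡level : Connected graph → ∀ {u} → level u ≡ 0 → (∀ w → level w ≡ 0 → w ≡ u) →
    (∀ w l → level w ≡ suc l → ∃[ x ] level x ≡ l) → ∀ w → dist graph u w ≡ level w
  dist≡level con {u} lu≡0 bottom descend w =
    ℕP.≤-antisym (Distance.dist-minimal graph (walk (level w) w refl))
                 (Distance.Lipschitz⇒≤dist graph con level-Lipschitz lu≡0 w)
    where
    walk : ∀ l w → level w ≡ l → reach graph l u w ≡ true
    walk zero    w lw≡0 rewrite bottom w lw≡0 = Walks.reachIn-refl graph allV refl
    walk (suc l) w lw≡1+l with x , lx≡l ← descend w l lw≡1+l =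
      reachIn-near {allV} {l} {u} {x} {w} (walk l x lx≡l) (consecutive lx≡l lw≡1+l) refl

module Extremal (k N : ℕ) where
  κ j D n : ℕ
  κ = suc k
  j = κ * suc N
  D = κ + κ + j
  n = suc D

  level : Fin n → ℕ
  level Fin.zero    = 0
  level (Fin.suc i) = [ [ (λ _ → 1) , (λ _ → 2) ]′ ∘ Fin.splitAt κ , (λ _ → 3) ]′ (Fin.splitAt (κ + κ) i)

  first second : Fin κ → Fin n
  first  i = Fin.suc ((i Fin.↑ˡ κ) Fin.↑ˡ j)
  second i = Fin.suc ((κ Fin.↑ʳ i) Fin.↑ˡ j)

  level-first : ∀ i → level (first i) ≡ 1
  level-first i rewrite FinP.splitAt-↑ˡ (κ + κ) (i Fin.↑ˡ κ) j | FinP.splitAt-↑ˡ κ i κ = refl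

  level-second : ∀ i → level (second i) ≡ 2
  level-second i rewrite FinP.splitAt-↑ˡ (κ + κ) (κ Fin.↑ʳ i) j | FinP.splitAt-↑ʳ κ κ i = refl

  level-third : ∀ i → level (Fin.suc ((κ + κ) Fin.↑ʳ i)) ≡ 3
  level-third i rewrite FinP.splitAt-↑ʳ (κ + κ) j i = refl

  ∑-level : ∀ g → ∑[ w < n ] g (level w) ≡ g 0 + ((κ * g 1 + κ * g 2) + j * g 3)
  ∑-level g = cong (g 0 +_) (begin
    ∑[ i < κ + κ + j ] g (level (Fin.suc i))
      ≡⟨ ∑-split (κ + κ) j (g ∘ level ∘ Fin.suc) ⟩
    ∑[ i < κ + κ ] g (level (Fin.suc (i Fin.↑ˡ j))) + ∑[ i < j ] g (level (Fin.suc ((κ + κ) Fin.↑ʳ i)))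
      ≡⟨ cong₂ _+_ (∑-split κ κ (λ i → g (level (Fin.suc (i Fin.↑ˡ j)))))
                   (trans (sum-cong-≗ (cong g ∘ level-third)) (∑-const j (g 3))) ⟩
    ∑[ i < κ ] g (level (first i)) + ∑[ i < κ ] g (level (second i)) + j * g 3
      ≡⟨ cong (_+ j * g 3) (cong₂ _+_ (trans (sum-cong-≗ (cong g ∘ level-first)) (∑-const κ (g 1)))
                                      (trans (sum-cong-≗ (cong g ∘ level-second)) (∑-const κ (g 2)))) ⟩
    κ * g 1 + κ * g 2 + j * g 3 ∎)
    where open ≡-Reasoning

  level≤3 : ∀ w → level w ≤ 3
  level≤3 Fin.zero    = z≤n
  level≤3 (Fin.suc i) with Fin.splitAt (κ + κ) i
  ... | inj₂ _ = ℕP.≤-refl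
  ... | inj₁ i′ with Fin.splitAt κ i′
  ...   | inj₁ _ = s≤s z≤n
  ...   | inj₂ _ = s≤s (s≤s z≤n)

  level≡0⇒zero : ∀ w → level w ≡ 0 → w ≡ Fin.zero
  level≡0⇒zero Fin.zero    _ = refl
  level≡0⇒zero (Fin.suc i) h with Fin.splitAt (κ + κ) i
  level≡0⇒zero (Fin.suc i) () | inj₂ _
  ... | inj₁ i′ with Fin.splitAt κ i′
  level≡0⇒zero (Fin.suc i) () | inj₁ i′ | inj₁ _
  level≡0⇒zero (Fin.suc i) () | inj₁ i′ | inj₂ _

  descend : ∀ w l → level w ≡ suc l → ∃[ x ] level x ≡ l
  descend w 0 _ = Fin.zero , refl
  descend w 1 _ = first Fin.zero , level-first Fin.zero
  descend w 2 _ = second Fin.zero , level-second Fin.zero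
  descend w (suc (suc (suc l))) lw≡4+l =
    ⊥-elim (ℕP.≤⇒≯ (level≤3 w) (subst (3 <_) (≡.sym lw≡4+l) (s≤s (s≤s (s≤s (s≤s z≤n))))))

  open LayeredGraph level public using (graph; reachIn-near)
  open PairCount graph level using (below)

  level-size : ∀ l → l ≡ 1 ⊎ l ≡ 2 → ∑[ w < n ] 𝟙 ⌊ level w ℕ.≟ l ⌋ ≡ κ
  level-size l l∈12 = trans (∑-level (λ L → 𝟙 ⌊ L ℕ.≟ l ⌋)) (count l∈12)
    where
    count : l ≡ 1 ⊎ l ≡ 2 →
      𝟙 ⌊ 0 ℕ.≟ l ⌋ + ((κ * 𝟙 ⌊ 1 ℕ.≟ l ⌋ + κ * 𝟙 ⌊ 2 ℕ.≟ l ⌋) + j * 𝟙 ⌊ 3 ℕ.≟ l ⌋) ≡ κ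
    count (inj₁ refl) = e₁ κ j
      where
      e₁ : ∀ κ j → 0 + ((κ * 1 + κ * 0) + j * 0) ≡ κ
      e₁ = solve-∀
    count (inj₂ refl) = e₂ κ j
      where
      e₂ : ∀ κ j → 0 + ((κ * 0 + κ * 1) + j * 0) ≡ κ
      e₂ = solve-∀

  kept-in-level : ∀ keep → suc (removed keep) ≤ κ → ∀ l → l ≡ 1 ⊎ l ≡ 2 → ∃[ w ] level w ≡ l × keep w ≡ true
  kept-in-level keep removed<κ l l∈12
    with w , lw≡l , kw ← kept-witness keep (λ w → ⌊ level w ℕ.≟ l ⌋)
                           (subst (suc (removed keep) ≤_) (≡.sym (level-size l l∈12)) removed<κ) =
    w , ⌊⌋-true⁻ (level w ℕ.≟ l) lw≡l , kw

  near-middle : ∀ {l} → l ≤ 3 → near l 1 ≡ true ⊎ near l 2 ≡ true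
  near-middle {l} l≤3 with ℕP.≤-<-connex l 2
  ... | inj₁ l≤2 = inj₁ (near-intro l≤2 (s≤s z≤n))
  ... | inj₂ 2<l = inj₂ (near-intro l≤3 (ℕP.m≤n⇒m≤1+n (ℕP.<⇒≤ 2<l)))

  middle-near : ∀ {x y} → 1 ≤ x × x ≤ 2 → 1 ≤ y × y ≤ 2 → near x y ≡ true
  middle-near (1≤x , x≤2) (1≤y , y≤2) = near-intro (ℕP.≤-trans x≤2 (s≤s 1≤y)) (ℕP.≤-trans y≤2 (s≤s 1≤x))

  KConnected-graph : KConnected κ graph
  KConnected-graph keep removed<κ = (a , ka) , λ u w ku kw → Walks.reachIn-mono graph keep 3≤n (three-steps ku kw)
    where
    a c : Fin n
    a = proj₁ (kept-in-level keep removed<κ 1 (inj₁ refl))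
    c = proj₁ (kept-in-level keep removed<κ 2 (inj₂ refl))
    la : level a ≡ 1
    la = proj₁ (proj₂ (kept-in-level keep removed<κ 1 (inj₁ refl)))
    lc : level c ≡ 2
    lc = proj₁ (proj₂ (kept-in-level keep removed<κ 2 (inj₂ refl)))
    ka : keep a ≡ true
    ka = proj₂ (proj₂ (kept-in-level keep removed<κ 1 (inj₁ refl)))
    kc : keep c ≡ true
    kc = proj₂ (proj₂ (kept-in-level keep removed<κ 2 (inj₂ refl)))

    hub : ∀ z → ∃[ h ] keep h ≡ true × (1 ≤ level h × level h ≤ 2) × near (level z) (level h) ≡ true
    hub z with near-middle (level≤3 z)
    ... | inj₁ near-a = a , ka , subst (λ l → 1 ≤ l × l ≤ 2) (≡.sym la) (s≤s z≤n , s≤s z≤n) ,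
                        subst (λ l → near (level z) l ≡ true) (≡.sym la) near-a
    ... | inj₂ near-c = c , kc , subst (λ l → 1 ≤ l × l ≤ 2) (≡.sym lc) (s≤s z≤n , s≤s (s≤s z≤n)) ,
                        subst (λ l → near (level z) l ≡ true) (≡.sym lc) near-c

    three-steps : ∀ {u w} → keep u ≡ true → keep w ≡ true → reachIn graph keep 3 u w ≡ true
    three-steps {u} {w} ku kw with hu , khu , hu-middle , u-near ← hub u | hw , khw , hw-middle , w-near ← hub w =
      reachIn-near {keep} {2} {u} {hw} {w}
        (reachIn-near {keep} {1} {u} {hu} {hw}
          (reachIn-near {keep} {0} {u} {u} {hu} (Walks.reachIn-refl graph keep ku) u-near khu)
          (middle-near hu-middle hw-middle) khw)
        (trans (near-sym (level hw) (level w)) w-near) kw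

    3≤n : 3 ≤ n
    3≤n = s≤s (ℕP.≤-trans (s≤s (ℕP.≤-trans (s≤s z≤n) (ℕP.m≤n+m κ k))) (ℕP.m≤m+n (κ + κ) j))

  connected : Connected graph
  connected u w =
    proj₂ (KConnected-graph allV (subst (λ r → suc r ≤ κ) (≡.sym (removed-none n)) (s≤s z≤n))) u w refl refl

  σ : ℕ
  σ = transmission graph Fin.zero

  σ≡ : σ ≡ κ + 2 * κ + 3 * j
  σ≡ = trans (transmission≡∑ graph Fin.zero)
             (trans (sum-cong-≗ (LayeredGraph.dist≡level level connected refl level≡0⇒zero descend))
                    (trans (∑-level id) (e κ j)))
    where
    e : ∀ κ j → 0 + ((κ * 1 + κ * 2) + j * 3) ≡ κ + 2 * κ + 3 * j
    e = solve-∀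

  ∑below≡ : ∑[ w < n ] below w ≡ κ + (1 + κ) * j
  ∑below≡ = trans (sum-cong-≗ (λ w → ∑-level (λ L → 𝟙 ⌊ 2 + L ≤? level w ⌋)))
                  (trans (∑-level (λ L → 𝟙 ⌊ 2 ≤? L ⌋ + ((κ * 𝟙 ⌊ 3 ≤? L ⌋ + κ * 𝟙 ⌊ 4 ≤? L ⌋) + j * 𝟙 ⌊ 5 ≤? L ⌋)))
                         (e κ j))
    where
    e : ∀ κ j → (0 + ((κ * 0 + κ * 0) + j * 0)) + ((κ * (0 + ((κ * 0 + κ * 0) + j * 0)) + κ * (1 + ((κ * 0 + κ * 0) + j * 0)))
                  + j * (1 + ((κ * 1 + κ * 0) + j * 0))) ≡ κ + (1 + κ) * j
    e = solve-∀

  size-identity : size graph + (σ + k) * κ ≡ D C 2 + 2 * D * κ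
  size-identity = ℕP.+-cancelʳ-≡ (κ + (1 + κ) * j) _ _ (begin
    size graph + (σ + k) * κ + (κ + (1 + κ) * j)          ≡⟨ e₁ (size graph) ((σ + k) * κ) (κ + (1 + κ) * j) ⟩
    (κ + (1 + κ) * j + size graph) + (σ + k) * κ          ≡⟨ cong₂ (λ x y → x + (y + k) * κ) pairs σ≡ ⟩
    (D + D C 2) + (κ + 2 * κ + 3 * j + k) * κ ≡⟨ e₂ k N (D C 2) ⟩
    D C 2 + 2 * D * κ + (κ + (1 + κ) * j)                 ∎)
    where
    open ≡-Reasoning
    pairs : κ + (1 + κ) * j + size graph ≡ D + D C 2
    pairs = trans (cong (_+ size graph) (≡.sym ∑below≡))
                  (trans (PairCount.∑below+size≡nC2 graph level (LayeredGraph.adjacent≡near level)) ([1+n]C2≡n+nC2 D))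
    e₁ : ∀ m x t → m + x + t ≡ (t + m) + x
    e₁ = solve-∀
    e₂ : ∀ k N c → let κ = suc k ; j = κ * suc N ; D = κ + κ + j in
      (D + c) + (κ + 2 * κ + 3 * j + k) * κ ≡ c + 2 * D * κ + (κ + (1 + κ) * j)
    e₂ = solve-∀

  2D≤σ+k : 2 * D ≤ σ + k
  2D≤σ+k = subst (2 * D ≤_) (≡.sym (trans (cong (_+ k) σ≡) (e k N))) (ℕP.m≤m+n (2 * D) (k + κ * N))
    where
    e : ∀ k N → let κ = suc k ; j = κ * suc N ; D = κ + κ + j in
      κ + 2 * κ + 3 * j + k ≡ 2 * D + (k + κ * N)
    e = solve-∀

  size≤ : size graph ≤ D C 2
  size≤ = ℕP.+-cancelʳ-≤ (2 * D * κ) _ _ (begin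
    size graph + 2 * D * κ     ≤⟨ ℕP.+-monoʳ-≤ (size graph) (ℕP.*-monoˡ-≤ κ 2D≤σ+k) ⟩
    size graph + (σ + k) * κ   ≡⟨ size-identity ⟩
    D C 2 + 2 * D * κ          ∎)
    where open ℕP.≤-Reasoning

  size≥ : n * (3 * κ) + 1 ≤ 2 * size graph + (n + 2 * κ * κ + κ)
  size≥ = ℕP.+-cancelʳ-≤ (2 * ((σ + k) * κ)) _ _ (begin
    n * (3 * κ) + 1 + 2 * ((σ + k) * κ)
      ≤⟨ ℕP.m≤m+n _ (κ * κ * suc N * N) ⟩
    n * (3 * κ) + 1 + 2 * ((σ + k) * κ) + κ * κ * suc N * N
      ≡⟨ cong (λ s → n * (3 * κ) + 1 + 2 * ((s + k) * κ) + κ * κ * suc N * N) σ≡ ⟩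
    n * (3 * κ) + 1 + 2 * ((κ + 2 * κ + 3 * j + k) * κ) + κ * κ * suc N * N
      ≡⟨ e₁ k N ⟩
    D * D + (4 * D * κ + (1 + 2 * κ * κ + κ))
      ≡⟨ cong (_+ (4 * D * κ + (1 + 2 * κ * κ + κ))) (≡.sym (n+2*nC2≡n*n D)) ⟩
    D + 2 * (D C 2) + (4 * D * κ + (1 + 2 * κ * κ + κ))
      ≡⟨ e₂ (D C 2) D κ ⟩
    2 * (D C 2 + 2 * D * κ) + (n + 2 * κ * κ + κ)
      ≡⟨ cong (λ x → 2 * x + (n + 2 * κ * κ + κ)) (≡.sym size-identity) ⟩
    2 * (size graph + (σ + k) * κ) + (n + 2 * κ * κ + κ)
      ≡⟨ e₃ (size graph) ((σ + k) * κ) (n + 2 * κ * κ + κ) ⟩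
    2 * size graph + (n + 2 * κ * κ + κ) + 2 * ((σ + k) * κ) ∎)
    where
    open ℕP.≤-Reasoning
    e₁ : ∀ k N → let κ = suc k ; j = κ * suc N ; D = κ + κ + j ; n = suc D in
      n * (3 * κ) + 1 + 2 * ((κ + 2 * κ + 3 * j + k) * κ) + κ * κ * suc N * N
        ≡ D * D + (4 * D * κ + (1 + 2 * κ * κ + κ))
    e₁ = solve-∀
    e₂ : ∀ c D κ → D + 2 * c + (4 * D * κ + (1 + 2 * κ * κ + κ)) ≡ 2 * (c + 2 * D * κ) + (suc D + 2 * κ * κ + κ)
    e₂ = solve-∀
    e₃ : ∀ m x q → 2 * (m + x) + q ≡ 2 * m + q + 2 * x
    e₃ = solve-∀

sizeRange-lower : ∀ κ n m → n * (3 * κ) + 1 ≤ 2 * m + (n + 2 * κ * κ + κ) →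
  ℤ.+ n ℤ.* (ℤ.+ (3 * κ) ℤ.- ℤ.+ 1) ℤ.- ℤ.+ (2 * κ * κ) ℤ.- ℤ.+ κ ℤ.+ ℤ.+ 1
    ℤ.- ℤ.+ κ ℤ.* (ℤ.+ κ ℤ.- ℤ.+ κ) ℤ.≤ ℤ.+ (2 * m)
sizeRange-lower κ n m h = begin
  ℤ.+ n ℤ.* (ℤ.+ (3 * κ) ℤ.- ℤ.+ 1) ℤ.- ℤ.+ (2 * κ * κ) ℤ.- ℤ.+ κ ℤ.+ ℤ.+ 1 ℤ.- ℤ.+ κ ℤ.* (ℤ.+ κ ℤ.- ℤ.+ κ)
    ≡⟨ e₁ (ℤ.+ n) (ℤ.+ (3 * κ)) (ℤ.+ (2 * κ * κ)) (ℤ.+ κ) ⟩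
  (ℤ.+ n ℤ.* ℤ.+ (3 * κ) ℤ.+ ℤ.+ 1) ℤ.- (ℤ.+ n ℤ.+ ℤ.+ (2 * κ * κ) ℤ.+ ℤ.+ κ)
    ≡⟨ cong₂ ℤ._-_ (≡.sym (trans (ℤP.pos-+ (n * (3 * κ)) 1) (cong (ℤ._+ ℤ.+ 1) (ℤP.pos-* n (3 * κ)))))
                   (≡.sym (trans (ℤP.pos-+ (n + 2 * κ * κ) κ) (cong (ℤ._+ ℤ.+ κ) (ℤP.pos-+ n (2 * κ * κ))))) ⟩
  ℤ.+ (n * (3 * κ) + 1) ℤ.- ℤ.+ Q
    ≤⟨ ℤP.+-monoˡ-≤ (ℤ.- ℤ.+ Q) (ℤ.+≤+ h) ⟩
  ℤ.+ (2 * m + Q) ℤ.- ℤ.+ Q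
    ≡⟨ trans (cong (ℤ._- ℤ.+ Q) (ℤP.pos-+ (2 * m) Q)) (e₂ (ℤ.+ (2 * m)) (ℤ.+ Q)) ⟩
  ℤ.+ (2 * m) ∎
  where
  open ℤP.≤-Reasoning
  Q = n + 2 * κ * κ + κ
  e₁ : ∀ a b c d → a ℤ.* (b ℤ.- ℤ.+ 1) ℤ.- c ℤ.- d ℤ.+ ℤ.+ 1 ℤ.- d ℤ.* (d ℤ.- d)
                  ≡ (a ℤ.* b ℤ.+ ℤ.+ 1) ℤ.- (a ℤ.+ c ℤ.+ d)
  e₁ = ℤ-Solver.solve-∀
  e₂ : ∀ a b → a ℤ.+ b ℤ.- b ≡ a
  e₂ = ℤ-Solver.solve-∀

remoteness-sharp : ∀ (κ N : ℕ) .{{_ : NonZero κ}} →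
  Σ ℕ (λ n → Σ (Graph n) (λ G → Σ ℕ (λ b → Σ ℕ (λ mstar →
    n ≥ N × n ≥ 2 × Connected G × KConnected κ G ×
    IsB κ n b × SizeRange κ n b (size G) × IsMStar κ n (size G) mstar ×
    remoteness G ≡ bound κ n mstar))))
remoteness-sharp (suc k) N =
  n , graph , κ , size graph , n≥N , 2≤n , connected , KConnected-graph , isB , sizeRange , isMStar ,
  ℚP.≤-antisym (remoteness-upper-bound κ n graph κ (size graph) 2≤n connected KConnected-graph isB sizeRange isMStar)
               (ℚP.≤-trans (ℚP.≤-reflexive bound≡meanDist) (ℚP.p≤p⊔q (meanDist graph Fin.zero) _))
  where
  open Extremal k N

  n≥N : n ≥ N
  n≥N = ℕP.≤-trans (ℕP.n≤1+n N)
          (ℕP.≤-trans (ℕP.m≤n*m (suc N) κ) (ℕP.≤-trans (ℕP.m≤n+m j (κ + κ)) (ℕP.n≤1+n D)))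

  2≤n : n ≥ 2
  2≤n = s≤s (s≤s z≤n)

  D≡0-mod-κ : κ + (2 + N) * κ ≡ D + 0 * κ
  D≡0-mod-κ = e k N
    where
    e : ∀ k N → let κ = suc k in κ + (2 + N) * κ ≡ κ + κ + κ * suc N + 0 * κ
    e = solve-∀

  isB : IsB κ n κ
  isB = s≤s z≤n , ℕP.≤-refl , same-residue {m = κ} {a = 2 + N} {c = D} {b = 0} D≡0-mod-κ

  sizeRange : SizeRange κ n κ (size graph)
  sizeRange = sizeRange-lower κ n (size graph) size≥ , size≤

  isMStar : IsMStar κ n (size graph) (size graph)
  isMStar = ℕP.≤-refl ,
            same-residue {m = size graph} {a = σ + k} {c = D C 2} {b = 2 * D} size-identity ,
            λ _ m≤m′ _ → m≤m′

  bound≡meanDist : bound κ n (size graph) ≡ meanDist graph Fin.zero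
  bound≡meanDist = trans (bound-split {k} {k + κ + j} {size graph} {σ} {0} (trans (ℕP.+-identityʳ _) size-identity))
                         (trans (cong (frac σ D ℚ.+_) (ℚP.0/n≡0 (κ * D))) (ℚP.+-identityʳ (frac σ D)))

mainTheorem3 : (∀ (κ n : ℕ) .{{_ : NonZero κ}} (G : Graph n) (b mstar : ℕ) →
      n ≥ 2 → Connected G → KConnected κ G →
      IsB κ n b → SizeRange κ n b (size G) → IsMStar κ n (size G) mstar →
      remoteness G ≤ℚ bound κ n mstar)
    ×
    (∀ (κ N : ℕ) .{{_ : NonZero κ}} →
      Σ ℕ (λ n → Σ (Graph n) (λ G → Σ ℕ (λ b → Σ ℕ (λ mstar →
        n ≥ N × n ≥ 2 × Connected G × KConnected κ G ×
        IsB κ n b × SizeRange κ n b (size G) × IsMStar κ n (size G) mstar ×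
        remoteness G ≡ bound κ n mstar)))))
mainTheorem3 = remoteness-upper-bound , remoteness-sharp
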